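{- Let $\psi\in\mathcal{D}$ be a DQBF and let $\exists y(D_y):\varphi$ be a subformula of $\psi$ such that $V^\forall_\varphi=V^\exists_\varphi=\emptyset$ and $V_\varphi\subseteq D_y\cup V^{\mathrm{free}}_\psi\cup\{v\in V^\exists_\psi\mid D_v\subseteq D_y\}$. Let $\psi'$ result from $\psi$ by replacing the subformula $\exists y(D_y):\varphi$ by $\varphi[0/y]\vee\varphi[1/y]$. Then $\psi$ and $\psi'$ are equisatisfiable.
   Context: Notation: $\mathcal{F}(W)$ is the set of Boolean functions over variable set $W$; $\mathrm{supp}(f)$ the set of variables $f$ depends on; $\varphi[c/y]$ substitutes the constant $c$ for $y$. Syntax (non-closed non-prenex DQBFs in NNF over a finite variable set $V$). The set $\mathcal{D}$, with for each $\psi$ the sets $V^{\exists}_\psi$ (existential), $V^{\forall}_\psi$ (universal), $V^{\mathrm{fs}}_\psi$ (free variables occurring in $\psi$), and a dependency set $D_y\subseteq V$ for each existential $y$, is the smallest set closed under: (1) $v\in\mathcal{D}$ for $v\in V$ ($V^\exists=V^\forall=\emptyset$, $V^{\mathrm{fs}}=\{v\}$); (2) $\neg v\in\mathcal{D}$, same sets; (3),(4) if $\varphi_1,\varphi_2\in\mathcal{D}$ and $\bigl(V^Q_{\varphi_1}\cup V^{\mathrm{fs}}_{\varphi_1}\cup\bigcup_{y\in V^\exists_{\varphi_1}}D_y\bigr)\cap V^Q_{\varphi_2}=\emptyset$ and symmetrically, then $(\varphi_1\wedge\varphi_2),(\varphi_1\vee\varphi_2)\in\mathcal{D}$ with all three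 sets the unions; (5) if $\varphi\in\mathcal{D}$, $v\in V^{\mathrm{free}}_\varphi$, $D_v\subseteq V\setminus(V^Q_\varphi\cup\{v\})$, then $\exists v(D_v):\varphi^{ -v}\in\mathcal{D}$ ($\varphi^{ -v}$: remove $v$ from all dependency sets in $\varphi$), with $V^\exists=V^\exists_\varphi\cup\{v\}$, $V^{\mathrm{fs}}=V^{\mathrm{fs}}_\varphi\setminus\{v\}$; (6) if $\varphi\in\mathcal{D}$, $v\in V^{\mathrm{free}}_\varphi$, then $\forall v:\varphi\in\mathcal{D}$ with $V^\forall=V^\forall_\varphi\cup\{v\}$, $V^{\mathrm{fs}}=V^{\mathrm{fs}}_\varphi\setminus\{v\}$. Here $V^Q_\psi=V^\exists_\psi\cup V^\forall_\psi$, $V_\psi=V^Q_\psi\cup V^{\mathrm{fs}}_\psi$, $V^{\mathrm{free}}_\psi=V\setminus V^Q_\psi$. Semantics. A Skolem function candidate for $\psi$ is a map $s:V^{\mathrm{free}}_\psi\cup V^\exists_\psi\to\mathcal{F}(V^\forall_\psi)$ with $s(v)$ constant for free $v$ and $\mathrm{supp}(s(v))\subseteq D_v\cap V^\forall_\psi$ for existential $v$. $s(\psi)$ replaces each such $v$ by $s(v)$ and deletes quantifiers. $[\![\psi]\!]$ is the set of candidates $s$ with $s(\psi)$ a tautology. $\psi_1\approx\psi_2$ (equisatisfiable) iff $[\![\psi_1]\!]=\emptyset\Leftrightarrow[\![\psi_2]\!]=\emptyset$. -}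

module Defs where

open import Data.Nat using (ℕ)
open import Data.Bool using (Bool; true; false; not; _∧_; _∨_; if_then_else_)
open import Data.Fin using (Fin; _≟_)
open import Data.Fin.Subset using (Subset; _∈_; _∉_; _⊆_; _∪_; _∩_; ∁; ⁅_⁆; _-_)
  renaming (⊥ to ∅)
open import Data.Fin.Subset.Properties using (_∈?_)
open import Data.Product using (Σ; _×_)
open import Data.Sum using (_⊎_)
open import Relation.Nullary using (¬_; yes; no; does)
open import Relation.Binary.PropositionalEquality using (_≡_)

-- Raw syntax of (non-closed, non-prenex) DQBFs in NNF over V = Fin n.
-- A node  ex v D φ  is  ∃ v (D) : φ ; a node  all v φ  is  ∀ v : φ.
-- Constants are an extension of the raw syntax needed only to write the
-- substitution φ[c/y]; they never occur in formulas of 𝒟 (see WF).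

data Form (n : ℕ) : Set where
  var   : Fin n → Form n
  neg   : Fin n → Form n
  const : Bool → Form n
  and   : Form n → Form n → Form n
  or    : Form n → Form n → Form n
  ex    : Fin n → Subset n → Form n → Form n
  all   : Fin n → Form n → Form n

-- One-hole contexts (to speak about subformula occurrences and replacement).
data Ctx (n : ℕ) : Set where
  hole : Ctx n
  andL : Ctx n → Form n → Ctx n
  andR : Form n → Ctx n → Ctx n
  orL  : Ctx n → Form n → Ctx n
  orR  : Form n → Ctx n → Ctx n
  exC  : Fin n → Subset n → Ctx n → Ctx n
  allC : Fin n → Ctx n → Ctx n

module _ {n : ℕ} where

  plug : Ctx n → Form n → Form n
  plug hole       χ = χ
  plug (andL C ψ) χ = and (plug C χ) ψ
  plug (andR ψ C) χ = and ψ (plug C χ)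
  plug (orL C ψ)  χ = or (plug C χ) ψ
  plug (orR ψ C)  χ = or ψ (plug C χ)
  plug (exC v D C) χ = ex v D (plug C χ)
  plug (allC v C) χ = all v (plug C χ)

  VE : Form n → Subset n
  VE (var v)    = ∅
  VE (neg v)    = ∅
  VE (const b)  = ∅
  VE (and φ ψ)  = VE φ ∪ VE ψ
  VE (or φ ψ)   = VE φ ∪ VE ψ
  VE (ex v D φ) = VE φ ∪ ⁅ v ⁆
  VE (all v φ)  = VE φ

  VA : Form n → Subset n
  VA (var v)    = ∅
  VA (neg v)    = ∅
  VA (const b)  = ∅
  VA (and φ ψ)  = VA φ ∪ VA ψ
  VA (or φ ψ)   = VA φ ∪ VA ψ
  VA (ex v D φ) = VA φ
  VA (all v φ)  = VA φ ∪ ⁅ v ⁆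

  Vfs : Form n → Subset n
  Vfs (var v)    = ⁅ v ⁆
  Vfs (neg v)    = ⁅ v ⁆
  Vfs (const b)  = ∅
  Vfs (and φ ψ)  = Vfs φ ∪ Vfs ψ
  Vfs (or φ ψ)   = Vfs φ ∪ Vfs ψ
  Vfs (ex v D φ) = Vfs φ - v
  Vfs (all v φ)  = Vfs φ - v

  VQ : Form n → Subset n
  VQ φ = VE φ ∪ VA φ

  Vars : Form n → Subset n
  Vars φ = VQ φ ∪ Vfs φ

  Vfree : Form n → Subset n
  Vfree φ = ∁ (VQ φ)

  -- Dependency set D_y of the existential variable y in ψ
  -- (the set attached to the quantifier ∃ y (D_y) in ψ; ∅ if y is not existential).
  depOf : Form n → Fin n → Subset n
  depOf (var v)    y = ∅
  depOf (neg v)    y = ∅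
  depOf (const b)  y = ∅
  depOf (and φ ψ)  y = depOf φ y ∪ depOf ψ y
  depOf (or φ ψ)   y = depOf φ y ∪ depOf ψ y
  depOf (ex v D φ) y = (if does (v ≟ y) then D else ∅) ∪ depOf φ y
  depOf (all v φ)  y = depOf φ y

  depsU : Form n → Subset n
  depsU (var v)    = ∅
  depsU (neg v)    = ∅
  depsU (const b)  = ∅
  depsU (and φ ψ)  = depsU φ ∪ depsU ψ
  depsU (or φ ψ)   = depsU φ ∪ depsU ψ
  depsU (ex v D φ) = D ∪ depsU φ
  depsU (all v φ)  = depsU φ

  removeDep : Fin n → Form n → Form n
  removeDep y (var v)    = var v
  removeDep y (neg v)    = neg v
  removeDep y (const b)  = const b
  removeDep y (and φ ψ)  = and (removeDep y φ) (removeDep y ψ)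
  removeDep y (or φ ψ)   = or (removeDep y φ) (removeDep y ψ)
  removeDep y (ex v D φ) = ex v (D - y) (removeDep y φ)
  removeDep y (all v φ)  = all v (removeDep y φ)

  subst : Form n → Fin n → Bool → Form n
  subst (var v)    y c = if does (v ≟ y) then const c else var v
  subst (neg v)    y c = if does (v ≟ y) then const (not c) else neg v
  subst (const b)  y c = const b
  subst (and φ ψ)  y c = and (subst φ y c) (subst ψ y c)
  subst (or φ ψ)   y c = or (subst φ y c) (subst ψ y c)
  subst (ex v D φ) y c = if does (v ≟ y) then ex v D φ else ex v D (subst φ y c)
  subst (all v φ)  y c = if does (v ≟ y) then all v φ else all v (subst φ y c)

  Disjoint : Subset n → Subset n → Set
  Disjoint A B = A ∩ B ≡ ∅

  data WF : Form n → Set where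
    wvar : (v : Fin n) → WF (var v)
    wneg : (v : Fin n) → WF (neg v)
    wand : {φ₁ φ₂ : Form n} → WF φ₁ → WF φ₂ →
           Disjoint (VQ φ₁ ∪ Vfs φ₁ ∪ depsU φ₁) (VQ φ₂) →
           Disjoint (VQ φ₂ ∪ Vfs φ₂ ∪ depsU φ₂) (VQ φ₁) →
           WF (and φ₁ φ₂)
    wor  : {φ₁ φ₂ : Form n} → WF φ₁ → WF φ₂ →
           Disjoint (VQ φ₁ ∪ Vfs φ₁ ∪ depsU φ₁) (VQ φ₂) →
           Disjoint (VQ φ₂ ∪ Vfs φ₂ ∪ depsU φ₂) (VQ φ₁) →
           WF (or φ₁ φ₂)
    wex  : {φ ψ : Form n} {v : Fin n} {D : Subset n} → WF φ →
           v ∈ Vfree φ → D ⊆ ∁ (VQ φ ∪ ⁅ v ⁆) → ψ ≡ removeDep v φ →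
           WF (ex v D ψ)
    wall : {φ : Form n} {v : Fin n} → WF φ → v ∈ Vfree φ → WF (all v φ)

  -- Assignments to V; a Boolean function over W is a function of
  -- assignments whose support is contained in W.
  Assignment : Set
  Assignment = Fin n → Bool

  SuppIn : (Assignment → Bool) → Subset n → Set
  SuppIn f W = (a b : Assignment) → ((x : Fin n) → x ∈ W → a x ≡ b x) → f a ≡ f b

  Dom : Form n → Subset n
  Dom ψ = Vfree ψ ∪ VE ψ

  CandFun : Form n → Set
  CandFun ψ = (v : Fin n) → v ∈ Dom ψ → Assignment → Bool

  IsCandidate : (ψ : Form n) → CandFun ψ → Set
  IsCandidate ψ s = (v : Fin n) (p : v ∈ Dom ψ) →
    SuppIn (s v p) (VA ψ) ×
    (v ∈ Vfree ψ → SuppIn (s v p) ∅) ×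
    (v ∈ VE ψ → SuppIn (s v p) (depOf ψ v ∩ VA ψ))

  -- value of the Boolean formula s(ψ) under an assignment a of the
  -- remaining (universal) variables
  evalWith : (ψ : Form n) → CandFun ψ → Assignment → Form n → Bool
  evalWith ψ s a (var v) with v ∈? Dom ψ
  ... | yes p = s v p a
  ... | no _  = a v
  evalWith ψ s a (neg v) with v ∈? Dom ψ
  ... | yes p = not (s v p a)
  ... | no _  = not (a v)
  evalWith ψ s a (const b)  = b
  evalWith ψ s a (and φ χ)  = evalWith ψ s a φ ∧ evalWith ψ s a χ
  evalWith ψ s a (or φ χ)   = evalWith ψ s a φ ∨ evalWith ψ s a χ
  evalWith ψ s a (ex v D φ) = evalWith ψ s a φ
  evalWith ψ s a (all v φ)  = evalWith ψ s a φ

  InSem : (ψ : Form n) → CandFun ψ → Set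
  InSem ψ s = IsCandidate ψ s × ((a : Assignment) → evalWith ψ s a ψ ≡ true)

  SemEmpty : Form n → Set
  SemEmpty ψ = ¬ (Σ (CandFun ψ) (InSem ψ))

  Equisat : Form n → Form n → Set
  Equisat ψ₁ ψ₂ = (SemEmpty ψ₁ → SemEmpty ψ₂) × (SemEmpty ψ₂ → SemEmpty ψ₁)

-- Under a valuation write g c for the value of φ[c/y]; the expansion evaluates to
-- g false ∨ g true, and g (g true) ≡ g false ∨ g true, so φ[1/y] is a Skolem witness for y.
-- Hence a Skolem candidate for ψ′ becomes one for ψ by letting y be the value of φ[1/y]
-- under it: by the hypothesis on V_φ every variable this value reads is itself controlled by
-- universals in D_y, so it respects D_y. Conversely a candidate for ψ serves ψ′ once y is
-- forgotten. Away from y both formulas have the same quantifier structure, and y does not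
-- occur beside the replaced subformula, so the rest of ψ evaluates identically.

module Submission where

open import Defs
open import Data.Nat using (ℕ)
open import Data.Bool using (Bool; true; false; not; _∧_; _∨_; if_then_else_; T)
open import Data.Bool.Properties using (∨-zeroʳ; ∨-identityʳ; T-∧; T-∨; T-≡)
open import Data.Fin using (Fin; zero; suc; _≟_)
open import Data.Fin.Subset using (Subset; _∈_; _∉_; _⊆_; _∪_; _∩_; ∁; ⁅_⁆; _-_) renaming (⊥ to ∅)
open import Data.Fin.Subset.Properties
  using ( _∈?_; ∉⊥; ⊆-min; x∈⁅x⁆; x∈⁅y⁆⇒x≡y; x∈∁p⇒x∉p; x∉p⇒x∈∁p; x∉∁p⇒x∈p
        ; x∈p∩q⁺; x∈p∩q⁻; p∩q⊆q; x∈p∪q⁺; x∈p∪q⁻; p⊆p∪q; q⊆p∪q; p─q⊆p; x∈p∧x≢y⇒x∈p-y )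
open import Data.Vec.Base using (_∷_; there)
open import Data.Product using (Σ; _×_; _,_; proj₁; proj₂)
import Data.Product as Product
open import Data.Sum using (_⊎_; inj₁; inj₂; [_,_]′)
import Data.Sum as Sum
open import Data.Empty using (⊥-elim)
open import Function using (_∘_; id)
open import Function.Bundles using (_⇔_; mk⇔; Equivalence)
open import Function.Construct.Symmetry using (⇔-sym)
open import Relation.Nullary using (yes; no; does; Dec)
open import Relation.Nullary.Decidable using (dec-true; dec-false)
open import Relation.Binary.PropositionalEquality as ≡ using (_≡_; _≢_; refl; sym; trans; cong; cong₂)

open Equivalence using (to; from)
open ≡.≡-Reasoning

x∉p-x : {m : ℕ} (x : Fin m) (p : Subset m) → x ∉ p - x
x∉p-x zero    (s ∷ p) ()
x∉p-x (suc x) (s ∷ p) (there x∈p-x) = x∉p-x x p x∈p-x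

module _ {n : ℕ} where

  ∪-map : {x : Fin n} {p p′ q q′ : Subset n} →
    (x ∈ p → x ∈ p′) → (x ∈ q → x ∈ q′) → x ∈ p ∪ q → x ∈ p′ ∪ q′
  ∪-map {p = p} {q = q} f g = x∈p∪q⁺ ∘ Sum.map f g ∘ x∈p∪q⁻ p q

  ∩-map : {x : Fin n} {p p′ q q′ : Subset n} →
    (x ∈ p → x ∈ p′) → (x ∈ q → x ∈ q′) → x ∈ p ∩ q → x ∈ p′ ∩ q′
  ∩-map {p = p} {q = q} f g = x∈p∩q⁺ ∘ Product.map f g ∘ x∈p∩q⁻ p q

  ∁-map : {x : Fin n} {p q : Subset n} → (x ∈ q → x ∈ p) → x ∈ ∁ p → x ∈ ∁ q
  ∁-map f x∈∁p = x∉p⇒x∈∁p (x∈∁p⇒x∉p x∈∁p ∘ f)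

  VE-plug-mono : (C : Ctx n) {χ χ′ : Form n} {x : Fin n} →
    (x ∈ VE χ → x ∈ VE χ′) → x ∈ VE (plug C χ) → x ∈ VE (plug C χ′)
  VE-plug-mono hole        f = f
  VE-plug-mono (andL C ψ)  f = ∪-map (VE-plug-mono C f) id
  VE-plug-mono (andR ψ C)  f = ∪-map id (VE-plug-mono C f)
  VE-plug-mono (orL C ψ)   f = ∪-map (VE-plug-mono C f) id
  VE-plug-mono (orR ψ C)   f = ∪-map id (VE-plug-mono C f)
  VE-plug-mono (exC v D C) f = ∪-map (VE-plug-mono C f) id
  VE-plug-mono (allC v C)  f = VE-plug-mono C f

  VA-plug-mono : (C : Ctx n) {χ χ′ : Form n} {x : Fin n} →
    (x ∈ VA χ → x ∈ VA χ′) → x ∈ VA (plug C χ) → x ∈ VA (plug C χ′)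
  VA-plug-mono hole        f = f
  VA-plug-mono (andL C ψ)  f = ∪-map (VA-plug-mono C f) id
  VA-plug-mono (andR ψ C)  f = ∪-map id (VA-plug-mono C f)
  VA-plug-mono (orL C ψ)   f = ∪-map (VA-plug-mono C f) id
  VA-plug-mono (orR ψ C)   f = ∪-map id (VA-plug-mono C f)
  VA-plug-mono (exC v D C) f = VA-plug-mono C f
  VA-plug-mono (allC v C)  f = ∪-map (VA-plug-mono C f) id

  depOf-plug-mono : (C : Ctx n) (z : Fin n) {χ χ′ : Form n} {x : Fin n} →
    (x ∈ depOf χ z → x ∈ depOf χ′ z) → x ∈ depOf (plug C χ) z → x ∈ depOf (plug C χ′) z
  depOf-plug-mono hole        z f = f
  depOf-plug-mono (andL C ψ)  z f = ∪-map (depOf-plug-mono C z f) id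
  depOf-plug-mono (andR ψ C)  z f = ∪-map id (depOf-plug-mono C z f)
  depOf-plug-mono (orL C ψ)   z f = ∪-map (depOf-plug-mono C z f) id
  depOf-plug-mono (orR ψ C)   z f = ∪-map id (depOf-plug-mono C z f)
  depOf-plug-mono (exC v D C) z f = ∪-map id (depOf-plug-mono C z f)
  depOf-plug-mono (allC v C)  z f = depOf-plug-mono C z f

  VE⊆VE-plug : (C : Ctx n) {χ : Form n} → VE χ ⊆ VE (plug C χ)
  VE⊆VE-plug hole        = id
  VE⊆VE-plug (andL C ψ)  = p⊆p∪q _ ∘ VE⊆VE-plug C
  VE⊆VE-plug (andR ψ C)  = q⊆p∪q _ _ ∘ VE⊆VE-plug C
  VE⊆VE-plug (orL C ψ)   = p⊆p∪q _ ∘ VE⊆VE-plug C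
  VE⊆VE-plug (orR ψ C)   = q⊆p∪q _ _ ∘ VE⊆VE-plug C
  VE⊆VE-plug (exC v D C) = p⊆p∪q _ ∘ VE⊆VE-plug C
  VE⊆VE-plug (allC v C)  = VE⊆VE-plug C

  VA⊆VA-plug : (C : Ctx n) {χ : Form n} → VA χ ⊆ VA (plug C χ)
  VA⊆VA-plug hole        = id
  VA⊆VA-plug (andL C ψ)  = p⊆p∪q _ ∘ VA⊆VA-plug C
  VA⊆VA-plug (andR ψ C)  = q⊆p∪q _ _ ∘ VA⊆VA-plug C
  VA⊆VA-plug (orL C ψ)   = p⊆p∪q _ ∘ VA⊆VA-plug C
  VA⊆VA-plug (orR ψ C)   = q⊆p∪q _ _ ∘ VA⊆VA-plug C
  VA⊆VA-plug (exC v D C) = VA⊆VA-plug C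
  VA⊆VA-plug (allC v C)  = p⊆p∪q _ ∘ VA⊆VA-plug C

  VQ⊆VQ-plug : (C : Ctx n) {χ : Form n} → VQ χ ⊆ VQ (plug C χ)
  VQ⊆VQ-plug C = ∪-map (VE⊆VE-plug C) (VA⊆VA-plug C)

  depOf⊆depOf-plug : (C : Ctx n) (z : Fin n) {χ : Form n} → depOf χ z ⊆ depOf (plug C χ) z
  depOf⊆depOf-plug hole        z = id
  depOf⊆depOf-plug (andL C ψ)  z = p⊆p∪q _ ∘ depOf⊆depOf-plug C z
  depOf⊆depOf-plug (andR ψ C)  z = q⊆p∪q _ _ ∘ depOf⊆depOf-plug C z
  depOf⊆depOf-plug (orL C ψ)   z = p⊆p∪q _ ∘ depOf⊆depOf-plug C z
  depOf⊆depOf-plug (orR ψ C)   z = q⊆p∪q _ _ ∘ depOf⊆depOf-plug C z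
  depOf⊆depOf-plug (exC v D C) z = q⊆p∪q _ _ ∘ depOf⊆depOf-plug C z
  depOf⊆depOf-plug (allC v C)  z = depOf⊆depOf-plug C z

  depsU⊆depsU-plug : (C : Ctx n) {χ : Form n} → depsU χ ⊆ depsU (plug C χ)
  depsU⊆depsU-plug hole        = id
  depsU⊆depsU-plug (andL C ψ)  = p⊆p∪q _ ∘ depsU⊆depsU-plug C
  depsU⊆depsU-plug (andR ψ C)  = q⊆p∪q _ _ ∘ depsU⊆depsU-plug C
  depsU⊆depsU-plug (orL C ψ)   = p⊆p∪q _ ∘ depsU⊆depsU-plug C
  depsU⊆depsU-plug (orR ψ C)   = q⊆p∪q _ _ ∘ depsU⊆depsU-plug C
  depsU⊆depsU-plug (exC v D C) = q⊆p∪q _ _ ∘ depsU⊆depsU-plug C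
  depsU⊆depsU-plug (allC v C)  = depsU⊆depsU-plug C

  sideVars : Ctx n → Subset n
  sideVars hole        = ∅
  sideVars (andL C ψ)  = sideVars C ∪ Vars ψ
  sideVars (andR ψ C)  = Vars ψ ∪ sideVars C
  sideVars (orL C ψ)   = sideVars C ∪ Vars ψ
  sideVars (orR ψ C)   = Vars ψ ∪ sideVars C
  sideVars (exC v D C) = sideVars C
  sideVars (allC v C)  = sideVars C

  VE-removeDep : (w : Fin n) (φ : Form n) → VE (removeDep w φ) ≡ VE φ
  VE-removeDep w (var v)    = refl
  VE-removeDep w (neg v)    = refl
  VE-removeDep w (const b)  = refl
  VE-removeDep w (and φ ψ)  = cong₂ _∪_ (VE-removeDep w φ) (VE-removeDep w ψ)
  VE-removeDep w (or φ ψ)   = cong₂ _∪_ (VE-removeDep w φ) (VE-removeDep w ψ)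
  VE-removeDep w (ex v D φ) = cong (_∪ ⁅ v ⁆) (VE-removeDep w φ)
  VE-removeDep w (all v φ)  = VE-removeDep w φ

  VA-removeDep : (w : Fin n) (φ : Form n) → VA (removeDep w φ) ≡ VA φ
  VA-removeDep w (var v)    = refl
  VA-removeDep w (neg v)    = refl
  VA-removeDep w (const b)  = refl
  VA-removeDep w (and φ ψ)  = cong₂ _∪_ (VA-removeDep w φ) (VA-removeDep w ψ)
  VA-removeDep w (or φ ψ)   = cong₂ _∪_ (VA-removeDep w φ) (VA-removeDep w ψ)
  VA-removeDep w (ex v D φ) = VA-removeDep w φ
  VA-removeDep w (all v φ)  = cong (_∪ ⁅ v ⁆) (VA-removeDep w φ)

  Vfs-removeDep : (w : Fin n) (φ : Form n) → Vfs (removeDep w φ) ≡ Vfs φ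
  Vfs-removeDep w (var v)    = refl
  Vfs-removeDep w (neg v)    = refl
  Vfs-removeDep w (const b)  = refl
  Vfs-removeDep w (and φ ψ)  = cong₂ _∪_ (Vfs-removeDep w φ) (Vfs-removeDep w ψ)
  Vfs-removeDep w (or φ ψ)   = cong₂ _∪_ (Vfs-removeDep w φ) (Vfs-removeDep w ψ)
  Vfs-removeDep w (ex v D φ) = cong (_- v) (Vfs-removeDep w φ)
  Vfs-removeDep w (all v φ)  = cong (_- v) (Vfs-removeDep w φ)

  VQ-removeDep : (w : Fin n) (φ : Form n) → VQ (removeDep w φ) ≡ VQ φ
  VQ-removeDep w φ = cong₂ _∪_ (VE-removeDep w φ) (VA-removeDep w φ)

  Vars-removeDep : (w : Fin n) (φ : Form n) → Vars (removeDep w φ) ≡ Vars φ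
  Vars-removeDep w φ = cong₂ _∪_ (VQ-removeDep w φ) (Vfs-removeDep w φ)

  depsU-removeDep : (w : Fin n) (φ : Form n) → depsU (removeDep w φ) ⊆ depsU φ
  depsU-removeDep w (var v)    = id
  depsU-removeDep w (neg v)    = id
  depsU-removeDep w (const b)  = id
  depsU-removeDep w (and φ ψ)  = ∪-map (depsU-removeDep w φ) (depsU-removeDep w ψ)
  depsU-removeDep w (or φ ψ)   = ∪-map (depsU-removeDep w φ) (depsU-removeDep w ψ)
  depsU-removeDep w (ex v D φ) = ∪-map (p─q⊆p D ⁅ w ⁆) (depsU-removeDep w φ)
  depsU-removeDep w (all v φ)  = depsU-removeDep w φ

  ∉depsU-removeDep : (w : Fin n) (φ : Form n) → w ∉ depsU (removeDep w φ)
  ∉depsU-removeDep w (var v)    = ∉⊥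
  ∉depsU-removeDep w (neg v)    = ∉⊥
  ∉depsU-removeDep w (const b)  = ∉⊥
  ∉depsU-removeDep w (and φ ψ)  =
    [ ∉depsU-removeDep w φ , ∉depsU-removeDep w ψ ]′ ∘ x∈p∪q⁻ _ _
  ∉depsU-removeDep w (or φ ψ)   =
    [ ∉depsU-removeDep w φ , ∉depsU-removeDep w ψ ]′ ∘ x∈p∪q⁻ _ _
  ∉depsU-removeDep w (ex v D φ) =
    [ x∉p-x w D , ∉depsU-removeDep w φ ]′ ∘ x∈p∪q⁻ _ _
  ∉depsU-removeDep w (all v φ)  = ∉depsU-removeDep w φ

  record Apart (φ ψ : Form n) : Set where
    field
      Vars-∉VQ  : {x : Fin n} → x ∈ Vars φ → x ∉ VQ ψ
      depsU-∉VE : {x : Fin n} → x ∈ depsU φ → x ∉ VE ψ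

  open Apart

  -- The side conditions of rules (3)-(5) used below. Unlike WF they are inherited by the
  -- body of ∃ v (D), which WF only constrains through removeDep v.
  data WellScoped : Form n → Set where
    var : (v : Fin n) → WellScoped (var v)
    neg : (v : Fin n) → WellScoped (neg v)
    and : {φ ψ : Form n} → WellScoped φ → WellScoped ψ → Apart φ ψ → Apart ψ φ → WellScoped (and φ ψ)
    or  : {φ ψ : Form n} → WellScoped φ → WellScoped ψ → Apart φ ψ → Apart ψ φ → WellScoped (or φ ψ)
    ex  : {φ : Form n} {v : Fin n} {D : Subset n} → WellScoped φ → v ∉ depsU φ → WellScoped (ex v D φ)
    all : {φ : Form n} {v : Fin n} → WellScoped φ → WellScoped (all v φ)

  Apart-removeDep : (w : Fin n) {φ ψ : Form n} → Apart φ ψ → Apart (removeDep w φ) (removeDep w ψ)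
  Apart-removeDep w {φ} {ψ} ap = record
    { Vars-∉VQ  = λ {x} m → Vars-∉VQ ap (≡.subst (x ∈_) (Vars-removeDep w φ) m)
                          ∘ ≡.subst (x ∈_) (VQ-removeDep w ψ)
    ; depsU-∉VE = λ {x} m → depsU-∉VE ap (depsU-removeDep w φ m)
                          ∘ ≡.subst (x ∈_) (VE-removeDep w ψ)
    }

  WellScoped-removeDep : (w : Fin n) {φ : Form n} → WellScoped φ → WellScoped (removeDep w φ)
  WellScoped-removeDep w (var v) = var v
  WellScoped-removeDep w (neg v) = neg v
  WellScoped-removeDep w (and sφ sψ ap ap′) =
    and (WellScoped-removeDep w sφ) (WellScoped-removeDep w sψ) (Apart-removeDep w ap) (Apart-removeDep w ap′)
  WellScoped-removeDep w (or sφ sψ ap ap′) =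
    or (WellScoped-removeDep w sφ) (WellScoped-removeDep w sψ) (Apart-removeDep w ap) (Apart-removeDep w ap′)
  WellScoped-removeDep w (ex {φ} sφ v∉) = ex (WellScoped-removeDep w sφ) (v∉ ∘ depsU-removeDep w φ)
  WellScoped-removeDep w (all sφ) = all (WellScoped-removeDep w sφ)

  Disjoint⇒Apart : {φ ψ : Form n} → Disjoint (VQ φ ∪ Vfs φ ∪ depsU φ) (VQ ψ) → Apart φ ψ
  Disjoint⇒Apart {φ} {ψ} disj = record
    { Vars-∉VQ  = λ m → apart (∪-map id (p⊆p∪q _) m)
    ; depsU-∉VE = λ m → apart (q⊆p∪q _ _ (q⊆p∪q _ _ m)) ∘ p⊆p∪q _
    }
    where
    apart : {x : Fin n} → x ∈ VQ φ ∪ Vfs φ ∪ depsU φ → x ∉ VQ ψ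
    apart m m′ = ∉⊥ (≡.subst (_ ∈_) disj (x∈p∩q⁺ (m , m′)))

  WF⇒WellScoped : {φ : Form n} → WF φ → WellScoped φ
  WF⇒WellScoped (wvar v) = var v
  WF⇒WellScoped (wneg v) = neg v
  WF⇒WellScoped (wand wφ wψ d d′) =
    and (WF⇒WellScoped wφ) (WF⇒WellScoped wψ) (Disjoint⇒Apart d) (Disjoint⇒Apart d′)
  WF⇒WellScoped (wor wφ wψ d d′) =
    or (WF⇒WellScoped wφ) (WF⇒WellScoped wψ) (Disjoint⇒Apart d) (Disjoint⇒Apart d′)
  WF⇒WellScoped (wex {φ} {v = v} wφ _ _ refl) =
    ex (WellScoped-removeDep v (WF⇒WellScoped wφ)) (∉depsU-removeDep v φ)
  WF⇒WellScoped (wall wφ _) = all (WF⇒WellScoped wφ)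

  VQ-hole-∉sideVars : (C : Ctx n) {χ : Form n} {x : Fin n} →
    WellScoped (plug C χ) → x ∈ VQ χ → x ∉ sideVars C
  VQ-hole-∉sideVars hole        _ _ = ∉⊥
  VQ-hole-∉sideVars (andL C ψ)  (and s _ _ ap) q =
    [ VQ-hole-∉sideVars C s q , (λ m → Vars-∉VQ ap m (VQ⊆VQ-plug C q)) ]′ ∘ x∈p∪q⁻ _ _
  VQ-hole-∉sideVars (andR ψ C)  (and _ s ap _) q =
    [ (λ m → Vars-∉VQ ap m (VQ⊆VQ-plug C q)) , VQ-hole-∉sideVars C s q ]′ ∘ x∈p∪q⁻ _ _
  VQ-hole-∉sideVars (orL C ψ)   (or s _ _ ap) q =
    [ VQ-hole-∉sideVars C s q , (λ m → Vars-∉VQ ap m (VQ⊆VQ-plug C q)) ]′ ∘ x∈p∪q⁻ _ _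
  VQ-hole-∉sideVars (orR ψ C)   (or _ s ap _) q =
    [ (λ m → Vars-∉VQ ap m (VQ⊆VQ-plug C q)) , VQ-hole-∉sideVars C s q ]′ ∘ x∈p∪q⁻ _ _
  VQ-hole-∉sideVars (exC v D C) (ex s _) q = VQ-hole-∉sideVars C s q
  VQ-hole-∉sideVars (allC v C)  (all s) q  = VQ-hole-∉sideVars C s q

  depsU-hole-∉VE : (C : Ctx n) {χ : Form n} {x : Fin n} →
    WellScoped (plug C χ) → x ∈ depsU χ → x ∉ VE χ → x ∉ VE (plug C χ)
  depsU-hole-∉VE hole        _ _ x∉ = x∉
  depsU-hole-∉VE (andL C ψ)  (and s _ ap _) d x∉ =
    [ depsU-hole-∉VE C s d x∉ , depsU-∉VE ap (depsU⊆depsU-plug C d) ]′ ∘ x∈p∪q⁻ _ _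
  depsU-hole-∉VE (andR ψ C)  (and _ s _ ap) d x∉ =
    [ depsU-∉VE ap (depsU⊆depsU-plug C d) , depsU-hole-∉VE C s d x∉ ]′ ∘ x∈p∪q⁻ _ _
  depsU-hole-∉VE (orL C ψ)   (or s _ ap _) d x∉ =
    [ depsU-hole-∉VE C s d x∉ , depsU-∉VE ap (depsU⊆depsU-plug C d) ]′ ∘ x∈p∪q⁻ _ _
  depsU-hole-∉VE (orR ψ C)   (or _ s _ ap) d x∉ =
    [ depsU-∉VE ap (depsU⊆depsU-plug C d) , depsU-hole-∉VE C s d x∉ ]′ ∘ x∈p∪q⁻ _ _
  depsU-hole-∉VE (exC v D C) {χ} (ex s v∉) d x∉ =
    [ depsU-hole-∉VE C s d x∉
    , (λ x≡v → v∉ (≡.subst (_∈ depsU (plug C χ)) (x∈⁅y⁆⇒x≡y v x≡v) (depsU⊆depsU-plug C d))) ]′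
    ∘ x∈p∪q⁻ _ _
  depsU-hole-∉VE (allC v C)  (all s) d x∉ = depsU-hole-∉VE C s d x∉

  data QF : Form n → Set where
    var   : (v : Fin n) → QF (var v)
    neg   : (v : Fin n) → QF (neg v)
    const : (b : Bool) → QF (const b)
    and   : {φ ψ : Form n} → QF φ → QF ψ → QF (and φ ψ)
    or    : {φ ψ : Form n} → QF φ → QF ψ → QF (or φ ψ)

  unquantified⇒QF : (φ : Form n) → (∀ {x} → x ∉ VQ φ) → QF φ
  unquantified⇒QF (var v)    _ = var v
  unquantified⇒QF (neg v)    _ = neg v
  unquantified⇒QF (const b)  _ = const b
  unquantified⇒QF (and φ ψ)  h =
    and (unquantified⇒QF φ (h ∘ ∪-map (p⊆p∪q _) (p⊆p∪q _)))
        (unquantified⇒QF ψ (h ∘ ∪-map (q⊆p∪q _ _) (q⊆p∪q _ _)))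
  unquantified⇒QF (or φ ψ)   h =
    or (unquantified⇒QF φ (h ∘ ∪-map (p⊆p∪q _) (p⊆p∪q _)))
       (unquantified⇒QF ψ (h ∘ ∪-map (q⊆p∪q _ _) (q⊆p∪q _ _)))
  unquantified⇒QF (ex v D φ) h = ⊥-elim (h (p⊆p∪q _ (q⊆p∪q _ _ (x∈⁅x⁆ v))))
  unquantified⇒QF (all v φ)  h = ⊥-elim (h (q⊆p∪q _ _ (q⊆p∪q _ _ (x∈⁅x⁆ v))))

  QF-∉VE : {φ : Form n} {x : Fin n} → QF φ → x ∉ VE φ
  QF-∉VE (var v)   = ∉⊥
  QF-∉VE (neg v)   = ∉⊥
  QF-∉VE (const b) = ∉⊥
  QF-∉VE (and q r) = [ QF-∉VE q , QF-∉VE r ]′ ∘ x∈p∪q⁻ _ _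
  QF-∉VE (or q r)  = [ QF-∉VE q , QF-∉VE r ]′ ∘ x∈p∪q⁻ _ _

  QF-∉VA : {φ : Form n} {x : Fin n} → QF φ → x ∉ VA φ
  QF-∉VA (var v)   = ∉⊥
  QF-∉VA (neg v)   = ∉⊥
  QF-∉VA (const b) = ∉⊥
  QF-∉VA (and q r) = [ QF-∉VA q , QF-∉VA r ]′ ∘ x∈p∪q⁻ _ _
  QF-∉VA (or q r)  = [ QF-∉VA q , QF-∉VA r ]′ ∘ x∈p∪q⁻ _ _

  QF-∉depOf : {φ : Form n} {x z : Fin n} → QF φ → x ∉ depOf φ z
  QF-∉depOf (var v)   = ∉⊥
  QF-∉depOf (neg v)   = ∉⊥
  QF-∉depOf (const b) = ∉⊥
  QF-∉depOf (and q r) = [ QF-∉depOf q , QF-∉depOf r ]′ ∘ x∈p∪q⁻ _ _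
  QF-∉depOf (or q r)  = [ QF-∉depOf q , QF-∉depOf r ]′ ∘ x∈p∪q⁻ _ _

  QF-subst : {φ : Form n} (y : Fin n) (c : Bool) → QF φ → QF (subst φ y c)
  QF-subst y c (var v) with does (v ≟ y)
  ... | true  = const c
  ... | false = var v
  QF-subst y c (neg v) with does (v ≟ y)
  ... | true  = const (not c)
  ... | false = neg v
  QF-subst y c (const b) = const b
  QF-subst y c (and q r) = and (QF-subst y c q) (QF-subst y c r)
  QF-subst y c (or q r)  = or (QF-subst y c q) (QF-subst y c r)

  eval : Assignment → Form n → Bool
  eval σ (var v)    = σ v
  eval σ (neg v)    = not (σ v)
  eval σ (const b)  = b
  eval σ (and φ ψ)  = eval σ φ ∧ eval σ ψ
  eval σ (or φ ψ)   = eval σ φ ∨ eval σ ψ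
  eval σ (ex v D φ) = eval σ φ
  eval σ (all v φ)  = eval σ φ

  Vars-∪ˡ : (φ ψ : Form n) → Vars φ ⊆ ((VE φ ∪ VE ψ) ∪ (VA φ ∪ VA ψ)) ∪ (Vfs φ ∪ Vfs ψ)
  Vars-∪ˡ φ ψ = ∪-map (∪-map (p⊆p∪q _) (p⊆p∪q _)) (p⊆p∪q _)

  Vars-∪ʳ : (φ ψ : Form n) → Vars ψ ⊆ ((VE φ ∪ VE ψ) ∪ (VA φ ∪ VA ψ)) ∪ (Vfs φ ∪ Vfs ψ)
  Vars-∪ʳ φ ψ = ∪-map (∪-map (q⊆p∪q _ _) (q⊆p∪q _ _)) (q⊆p∪q _ _)

  Vars⊆Vars-ex : (v : Fin n) (D : Subset n) (φ : Form n) → Vars φ ⊆ Vars (ex v D φ)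
  Vars⊆Vars-ex v D φ {x} m with x∈p∪q⁻ (VQ φ) (Vfs φ) m | x ≟ v
  ... | inj₁ q | _        = p⊆p∪q _ (∪-map (p⊆p∪q _) id q)
  ... | inj₂ f | no x≢v   = q⊆p∪q _ _ (x∈p∧x≢y⇒x∈p-y f x≢v)
  ... | inj₂ _ | yes refl = p⊆p∪q _ (p⊆p∪q _ (q⊆p∪q _ _ (x∈⁅x⁆ x)))

  Vars⊆Vars-all : (v : Fin n) (φ : Form n) → Vars φ ⊆ Vars (all v φ)
  Vars⊆Vars-all v φ {x} m with x∈p∪q⁻ (VQ φ) (Vfs φ) m | x ≟ v
  ... | inj₁ q | _        = p⊆p∪q _ (∪-map id (p⊆p∪q _) q)
  ... | inj₂ f | no x≢v   = q⊆p∪q _ _ (x∈p∧x≢y⇒x∈p-y f x≢v)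
  ... | inj₂ _ | yes refl = p⊆p∪q _ (q⊆p∪q _ _ (q⊆p∪q _ _ (x∈⁅x⁆ x)))

  eval-cong : {σ τ : Assignment} (φ : Form n) → (∀ {x} → x ∈ Vars φ → σ x ≡ τ x) → eval σ φ ≡ eval τ φ
  eval-cong (var v)    agree = agree (q⊆p∪q _ _ (x∈⁅x⁆ v))
  eval-cong (neg v)    agree = cong not (agree (q⊆p∪q _ _ (x∈⁅x⁆ v)))
  eval-cong (const b)  agree = refl
  eval-cong (and φ ψ)  agree =
    cong₂ _∧_ (eval-cong φ (agree ∘ Vars-∪ˡ φ ψ)) (eval-cong ψ (agree ∘ Vars-∪ʳ φ ψ))
  eval-cong (or φ ψ)   agree =
    cong₂ _∨_ (eval-cong φ (agree ∘ Vars-∪ˡ φ ψ)) (eval-cong ψ (agree ∘ Vars-∪ʳ φ ψ))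
  eval-cong (ex v D φ) agree = eval-cong φ (agree ∘ Vars⊆Vars-ex v D φ)
  eval-cong (all v φ)  agree = eval-cong φ (agree ∘ Vars⊆Vars-all v φ)

  eval-cong-∉ : {σ τ : Assignment} {y : Fin n} (φ : Form n) → y ∉ Vars φ →
    (∀ {x} → x ≢ y → σ x ≡ τ x) → eval σ φ ≡ eval τ φ
  eval-cong-∉ φ y∉ agree = eval-cong φ (λ m → agree (λ { refl → y∉ m }))

  update : Assignment → Fin n → Bool → Assignment
  update σ y c x = if does (x ≟ y) then c else σ x

  update-≢ : (σ : Assignment) {x y : Fin n} (c : Bool) → x ≢ y → update σ y c x ≡ σ x
  update-≢ σ {x} {y} c x≢y rewrite dec-false (x ≟ y) x≢y = refl

  update-≡ : (σ : Assignment) (y : Fin n) (c : Bool) → update σ y c y ≡ c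
  update-≡ σ y c rewrite dec-true (y ≟ y) refl = refl

  update-agreeing : {σ τ : Assignment} {y : Fin n} → (∀ {x} → x ≢ y → σ x ≡ τ x) →
    ∀ {x} → σ x ≡ update τ y (σ y) x
  update-agreeing {y = y} agree {x} with x ≟ y
  ... | yes refl = refl
  ... | no x≢y   = agree x≢y

  update-cong : (σ τ : Assignment) {y x : Fin n} (c : Bool) → (x ≢ y → σ x ≡ τ x) →
    update σ y c x ≡ update τ y c x
  update-cong σ τ {y} {x} c agree with x ≟ y
  ... | yes _  = refl
  ... | no x≢y = agree x≢y

  eval-subst : {φ : Form n} (τ : Assignment) (y : Fin n) (c : Bool) → QF φ →
    eval τ (subst φ y c) ≡ eval (update τ y c) φ
  eval-subst τ y c (var v) with does (v ≟ y)
  ... | true  = refl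
  ... | false = refl
  eval-subst τ y c (neg v) with does (v ≟ y)
  ... | true  = refl
  ... | false = refl
  eval-subst τ y c (const b) = refl
  eval-subst τ y c (and q r) = cong₂ _∧_ (eval-subst τ y c q) (eval-subst τ y c r)
  eval-subst τ y c (or q r)  = cong₂ _∨_ (eval-subst τ y c q) (eval-subst τ y c r)

  eval-agreeing : {σ τ : Assignment} {y : Fin n} {φ : Form n} → QF φ →
    (∀ {x} → x ≢ y → σ x ≡ τ x) → eval σ φ ≡ eval τ (subst φ y (σ y))
  eval-agreeing {σ} {τ} {y} {φ} q agree =
    trans (eval-cong φ (λ _ → update-agreeing agree)) (sym (eval-subst τ y (σ y) q))

  T-at⇒T-∨ : (g : Bool → Bool) (c : Bool) → T (g c) → T (g false ∨ g true)
  T-at⇒T-∨ g false = T-∨ .from ∘ inj₁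
  T-at⇒T-∨ g true  = T-∨ .from ∘ inj₂

  ∨-at-witness : (g : Bool → Bool) → g false ∨ g true ≡ g (g true)
  ∨-at-witness g with g true in eq
  ... | true  = trans (∨-zeroʳ (g false)) (sym eq)
  ... | false = ∨-identityʳ (g false)

  valueOf : (ψ : Form n) → CandFun ψ → (v : Fin n) → Dec (v ∈ Dom ψ) → Assignment → Bool
  valueOf ψ s v (yes v∈) = s v v∈
  valueOf ψ s v (no _)   = λ a → a v

  valuation : (ψ : Form n) → CandFun ψ → Assignment → Assignment
  valuation ψ s a v = valueOf ψ s v (v ∈? Dom ψ) a

  evalWith≡eval : (ψ : Form n) (s : CandFun ψ) (a : Assignment) (φ : Form n) →
    evalWith ψ s a φ ≡ eval (valuation ψ s a) φ
  evalWith≡eval ψ s a (var v) with v ∈? Dom ψ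
  ... | yes _ = refl
  ... | no _  = refl
  evalWith≡eval ψ s a (neg v) with v ∈? Dom ψ
  ... | yes _ = refl
  ... | no _  = refl
  evalWith≡eval ψ s a (const b)  = refl
  evalWith≡eval ψ s a (and φ χ)  = cong₂ _∧_ (evalWith≡eval ψ s a φ) (evalWith≡eval ψ s a χ)
  evalWith≡eval ψ s a (or φ χ)   = cong₂ _∨_ (evalWith≡eval ψ s a φ) (evalWith≡eval ψ s a χ)
  evalWith≡eval ψ s a (ex v D φ) = evalWith≡eval ψ s a φ
  evalWith≡eval ψ s a (all v φ)  = evalWith≡eval ψ s a φ

  evalWith-true⇔ : (ψ : Form n) (s : CandFun ψ) (a : Assignment) →
    evalWith ψ s a ψ ≡ true ⇔ T (eval (valuation ψ s a) ψ)
  evalWith-true⇔ ψ s a rewrite evalWith≡eval ψ s a ψ = ⇔-sym T-≡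

  ∉Dom⇒∈VA : (ψ : Form n) {v : Fin n} → v ∉ Dom ψ → v ∈ VA ψ
  ∉Dom⇒∈VA ψ v∉ =
    [ ⊥-elim ∘ v∉ ∘ q⊆p∪q _ _ , id ]′ (x∈p∪q⁻ _ _ (x∉∁p⇒x∈p (v∉ ∘ p⊆p∪q _)))

  valuation-∉Dom : {ψ : Form n} (s : CandFun ψ) {v : Fin n} → v ∉ Dom ψ →
    (a : Assignment) → valuation ψ s a v ≡ a v
  valuation-∉Dom {ψ} s {v} v∉ = valueOf-∉ (v ∈? Dom ψ)
    where
    valueOf-∉ : (d : Dec (v ∈ Dom ψ)) (a : Assignment) → valueOf ψ s v d a ≡ a v
    valueOf-∉ (yes v∈) = ⊥-elim (v∉ v∈)
    valueOf-∉ (no _)   = λ _ → refl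

  SuppIn-mono : {f : Assignment → Bool} {W W′ : Subset n} → W ⊆ W′ → SuppIn f W → SuppIn f W′
  SuppIn-mono W⊆W′ supp a b agree = supp a b (λ x → agree x ∘ W⊆W′)

  -- IsCandidate ψ s is definitionally ∀ v p → CandidateAt ψ v (s v p).
  CandidateAt : Form n → Fin n → (Assignment → Bool) → Set
  CandidateAt ψ v f =
    SuppIn f (VA ψ) × (v ∈ Vfree ψ → SuppIn f ∅) × (v ∈ VE ψ → SuppIn f (depOf ψ v ∩ VA ψ))

  const-candidateAt : {ψ : Form n} {v : Fin n} (b : Bool) → CandidateAt ψ v (λ _ → b)
  const-candidateAt b = const-supp , (λ _ → const-supp) , (λ _ → const-supp)
    where
    const-supp : {W : Subset n} → SuppIn (λ _ → b) W
    const-supp _ _ _ = refl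

  existential-candidateAt : {ψ : Form n} {v : Fin n} {f : Assignment → Bool} →
    v ∈ VE ψ → SuppIn f (depOf ψ v ∩ VA ψ) → CandidateAt ψ v f
  existential-candidateAt v∈VE supp =
    SuppIn-mono (p∩q⊆q _ _) supp , (λ v∈free → ⊥-elim (x∈∁p⇒x∉p v∈free (p⊆p∪q _ v∈VE))) , (λ _ → supp)

  valuation-candidateAt : {ψ : Form n} {s : CandFun ψ} → IsCandidate ψ s →
    {v : Fin n} → v ∈ Dom ψ → CandidateAt ψ v (λ a → valuation ψ s a v)
  valuation-candidateAt {ψ} {s} cand {v} v∈ = valueOf-candidateAt (v ∈? Dom ψ)
    where
    valueOf-candidateAt : (d : Dec (v ∈ Dom ψ)) → CandidateAt ψ v (valueOf ψ s v d)
    valueOf-candidateAt (yes v∈′) = cand v v∈′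
    valueOf-candidateAt (no v∉)   = ⊥-elim (v∉ v∈)

  valuation-∉VE-supp : {ψ : Form n} {s : CandFun ψ} → IsCandidate ψ s →
    {v : Fin n} → v ∉ VE ψ → SuppIn (λ a → valuation ψ s a v) (⁅ v ⁆ ∩ VA ψ)
  valuation-∉VE-supp {ψ} {s} cand {v} v∉VE with v ∈? Dom ψ
  ... | no v∉   = λ a b agree → agree v (x∈p∩q⁺ (x∈⁅x⁆ v , ∉Dom⇒∈VA ψ v∉))
  ... | yes v∈ = [ (λ free → SuppIn-mono (⊆-min _) (proj₁ (proj₂ (cand v v∈)) free))
                 , ⊥-elim ∘ v∉VE ]′ (x∈p∪q⁻ _ _ v∈)

  record Similar (y : Fin n) (ψ ψ′ : Form n) : Set where
    field
      VA⇔    : {x : Fin n} → x ∈ VA ψ ⇔ x ∈ VA ψ′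
      VE⇔    : {x : Fin n} → x ≢ y → x ∈ VE ψ ⇔ x ∈ VE ψ′
      depOf⇔ : {v x : Fin n} → v ≢ y → x ∈ depOf ψ v ⇔ x ∈ depOf ψ′ v

    VQ⇔ : {x : Fin n} → x ≢ y → x ∈ VQ ψ ⇔ x ∈ VQ ψ′
    VQ⇔ x≢y = mk⇔ (∪-map (VE⇔ x≢y .to) (VA⇔ .to)) (∪-map (VE⇔ x≢y .from) (VA⇔ .from))

    Vfree⇔ : {x : Fin n} → x ≢ y → x ∈ Vfree ψ ⇔ x ∈ Vfree ψ′
    Vfree⇔ x≢y = mk⇔ (∁-map (VQ⇔ x≢y .from)) (∁-map (VQ⇔ x≢y .to))

    Dom⇔ : {x : Fin n} → x ≢ y → x ∈ Dom ψ ⇔ x ∈ Dom ψ′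
    Dom⇔ x≢y = mk⇔ (∪-map (Vfree⇔ x≢y .to) (VE⇔ x≢y .to)) (∪-map (Vfree⇔ x≢y .from) (VE⇔ x≢y .from))

  open Similar

  Similar-sym : {y : Fin n} {ψ ψ′ : Form n} → Similar y ψ ψ′ → Similar y ψ′ ψ
  Similar-sym sim = record
    { VA⇔    = ⇔-sym (VA⇔ sim)
    ; VE⇔    = ⇔-sym ∘ VE⇔ sim
    ; depOf⇔ = ⇔-sym ∘ depOf⇔ sim
    }

  CandidateAt-similar : {y v : Fin n} {ψ ψ′ : Form n} {f : Assignment → Bool} →
    Similar y ψ ψ′ → v ≢ y → CandidateAt ψ v f → CandidateAt ψ′ v f
  CandidateAt-similar sim v≢y (supp , free , exist) =
    SuppIn-mono (VA⇔ sim .to) supp ,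
    free ∘ Vfree⇔ sim v≢y .from ,
    SuppIn-mono (∩-map (depOf⇔ sim v≢y .to) (VA⇔ sim .to)) ∘ exist ∘ VE⇔ sim v≢y .from

  override : (ψ : Form n) → CandFun ψ → Fin n → (Assignment → Bool) → (ψ′ : Form n) → CandFun ψ′
  override ψ s y w ψ′ v _ a = update (valuation ψ s a) y (w a) v

  module _ {y : Fin n} {ψ ψ′ : Form n} {s : CandFun ψ} {w : Assignment {n} → Bool} where

    valuation-override-≢ : Similar y ψ ψ′ → {x : Fin n} → x ≢ y → (a : Assignment) →
      valuation ψ′ (override ψ s y w ψ′) a x ≡ valuation ψ s a x
    valuation-override-≢ sim {x} x≢y a = valueOf-override (x ∈? Dom ψ′)
      where
      valueOf-override : (d : Dec (x ∈ Dom ψ′)) → valueOf ψ′ (override ψ s y w ψ′) x d a ≡ valuation ψ s a x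
      valueOf-override (yes _) = update-≢ (valuation ψ s a) (w a) x≢y
      valueOf-override (no x∉) = sym (valuation-∉Dom s (x∉ ∘ Dom⇔ sim x≢y .to) a)

    valuation-override-≡ : y ∈ Dom ψ′ → (a : Assignment) → valuation ψ′ (override ψ s y w ψ′) a y ≡ w a
    valuation-override-≡ y∈ a = valueOf-override (y ∈? Dom ψ′)
      where
      valueOf-override : (d : Dec (y ∈ Dom ψ′)) → valueOf ψ′ (override ψ s y w ψ′) y d a ≡ w a
      valueOf-override (yes _)  = update-≡ (valuation ψ s a) y (w a)
      valueOf-override (no y∉) = ⊥-elim (y∉ y∈)

    override-isCandidate : Similar y ψ ψ′ → IsCandidate ψ s → CandidateAt ψ′ y w →
      IsCandidate ψ′ (override ψ s y w ψ′)
    override-isCandidate sim cand cand-y v v∈ with v ≟ y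
    ... | yes refl = cand-y
    ... | no v≢y   = CandidateAt-similar sim v≢y (valuation-candidateAt cand (Dom⇔ sim v≢y .from v∈))

  plug-true : (C : Ctx n) {χ χ′ : Form n} {σ τ : Assignment} {y : Fin n} → y ∉ sideVars C →
    (∀ {x} → x ≢ y → σ x ≡ τ x) → (T (eval σ χ) → T (eval τ χ′)) →
    T (eval σ (plug C χ)) → T (eval τ (plug C χ′))
  plug-true hole        y∉ agree hole-true = hole-true
  plug-true (andL C ψ)  y∉ agree hole-true = T-∧ .from ∘ Product.map
    (plug-true C (y∉ ∘ p⊆p∪q _) agree hole-true) (≡.subst T (eval-cong-∉ ψ (y∉ ∘ q⊆p∪q _ _) agree)) ∘ T-∧ .to
  plug-true (andR ψ C)  y∉ agree hole-true = T-∧ .from ∘ Product.map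
    (≡.subst T (eval-cong-∉ ψ (y∉ ∘ p⊆p∪q _) agree)) (plug-true C (y∉ ∘ q⊆p∪q _ _) agree hole-true) ∘ T-∧ .to
  plug-true (orL C ψ)   y∉ agree hole-true = T-∨ .from ∘ Sum.map
    (plug-true C (y∉ ∘ p⊆p∪q _) agree hole-true) (≡.subst T (eval-cong-∉ ψ (y∉ ∘ q⊆p∪q _ _) agree)) ∘ T-∨ .to
  plug-true (orR ψ C)   y∉ agree hole-true = T-∨ .from ∘ Sum.map
    (≡.subst T (eval-cong-∉ ψ (y∉ ∘ p⊆p∪q _) agree)) (plug-true C (y∉ ∘ q⊆p∪q _ _) agree hole-true) ∘ T-∨ .to
  plug-true (exC v D C) y∉ agree hole-true = plug-true C y∉ agree hole-true
  plug-true (allC v C)  y∉ agree hole-true = plug-true C y∉ agree hole-true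

  override-inSem : (C : Ctx n) {χ χ′ : Form n} {y : Fin n} (s : CandFun (plug C χ)) (w : Assignment → Bool) →
    let ψ = plug C χ; ψ′ = plug C χ′; s′ = override ψ s y w ψ′ in
    Similar y ψ ψ′ → y ∉ sideVars C → CandidateAt ψ′ y w →
    (∀ a → (∀ {x} → x ≢ y → valuation ψ s a x ≡ valuation ψ′ s′ a x) →
      T (eval (valuation ψ s a) χ) → T (eval (valuation ψ′ s′ a) χ′)) →
    InSem ψ s → InSem ψ′ s′
  override-inSem C {χ} {χ′} s w sim y∉ cand-y in-hole (cand , taut) =
    override-isCandidate sim cand cand-y ,
    λ a → let agree = λ {x} (x≢y : x ≢ _) → sym (valuation-override-≢ sim x≢y a) in
      evalWith-true⇔ (plug C χ′) _ a .from
        (plug-true C y∉ agree (in-hole a agree) (evalWith-true⇔ (plug C χ) s a .to (taut a)))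

  module Expansion (C : Ctx n) (y : Fin n) (Dy : Subset n) (φ : Form n) (qf : QF φ) where

    P P′ : Form n
    P  = plug C (ex y Dy φ)
    P′ = plug C (or (subst φ y false) (subst φ y true))

    expansion-QF : QF (or (subst φ y false) (subst φ y true))
    expansion-QF = or (QF-subst y false qf) (QF-subst y true qf)

    ∉depOf-∃ : {v x : Fin n} → v ≢ y → x ∉ depOf (ex y Dy φ) v
    ∉depOf-∃ {v} v≢y rewrite dec-false (y ≟ v) (v≢y ∘ sym) = [ ∉⊥ , QF-∉depOf qf ]′ ∘ x∈p∪q⁻ _ _

    Dy⊆depOf-∃ : Dy ⊆ depOf (ex y Dy φ) y
    Dy⊆depOf-∃ {x} x∈Dy rewrite dec-true (y ≟ y) refl = p⊆p∪q _ x∈Dy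

    similar : Similar y P P′
    similar = record
      { VA⇔    = mk⇔ (VA-plug-mono C (⊥-elim ∘ QF-∉VA qf)) (VA-plug-mono C (⊥-elim ∘ QF-∉VA expansion-QF))
      ; VE⇔    = λ x≢y → mk⇔
          (VE-plug-mono C ([ ⊥-elim ∘ QF-∉VE qf , ⊥-elim ∘ x≢y ∘ x∈⁅y⁆⇒x≡y y ]′ ∘ x∈p∪q⁻ _ _))
          (VE-plug-mono C (⊥-elim ∘ QF-∉VE expansion-QF))
      ; depOf⇔ = λ v≢y → mk⇔
          (depOf-plug-mono C _ (⊥-elim ∘ ∉depOf-∃ v≢y))
          (depOf-plug-mono C _ (⊥-elim ∘ QF-∉depOf expansion-QF))
      }

    y∈VE : y ∈ VE P
    y∈VE = VE⊆VE-plug C (q⊆p∪q _ _ (x∈⁅x⁆ y))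

    module _ (scoped : WellScoped P) where

      y∉sideVars : y ∉ sideVars C
      y∉sideVars = VQ-hole-∉sideVars C scoped (p⊆p∪q _ (q⊆p∪q _ _ (x∈⁅x⁆ y)))

      Dy-∉VE : {x : Fin n} → x ∈ Dy → x ≢ y → x ∉ VE P
      Dy-∉VE x∈Dy x≢y = depsU-hole-∉VE C scoped (p⊆p∪q _ x∈Dy)
        ([ QF-∉VE qf , x≢y ∘ x∈⁅y⁆⇒x≡y y ]′ ∘ x∈p∪q⁻ _ _)

      satisfiable⇒expansion-satisfiable : Σ (CandFun P) (InSem P) → Σ (CandFun P′) (InSem P′)
      satisfiable⇒expansion-satisfiable (s , inSem) =
        s′ , override-inSem C s (λ _ → false) similar y∉sideVars (const-candidateAt {ψ = P′} false) in-hole inSem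
        where
        -- y no longer occurs in P′, so any constant will do.
        s′ : CandFun P′
        s′ = override P s y (λ _ → false) P′

        in-hole : ∀ a → (∀ {x} → x ≢ y → valuation P s a x ≡ valuation P′ s′ a x) →
          T (eval (valuation P s a) φ) → T (eval (valuation P′ s′ a) (or (subst φ y false) (subst φ y true)))
        in-hole a agree = T-at⇒T-∨ (λ c → eval (valuation P′ s′ a) (subst φ y c)) (valuation P s a y)
                        ∘ ≡.subst T (eval-agreeing qf agree)

      Determined : Fin n → Set
      Determined x = x ∈ Dy ⊎ x ∈ Vfree P ⊎ (x ∈ VE P × depOf P x ⊆ Dy)

      determined-supp : {s′ : CandFun P′} → IsCandidate P′ s′ → {x : Fin n} → x ≢ y → Determined x →
        SuppIn (λ a → valuation P′ s′ a x) (Dy ∩ VA P)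
      determined-supp cand′ x≢y (inj₁ x∈Dy) =
        SuppIn-mono (∩-map (λ z∈⁅x⁆ → ≡.subst (_∈ Dy) (sym (x∈⁅y⁆⇒x≡y _ z∈⁅x⁆)) x∈Dy) (VA⇔ similar .from))
          (valuation-∉VE-supp cand′ (Dy-∉VE x∈Dy x≢y ∘ VE⇔ similar x≢y .from))
      determined-supp cand′ x≢y (inj₂ (inj₁ x∈free)) =
        SuppIn-mono (⊆-min _) (proj₁ (proj₂ (valuation-candidateAt cand′ (p⊆p∪q _ x∈free′))) x∈free′)
        where
        x∈free′ = Vfree⇔ similar x≢y .to x∈free
      determined-supp cand′ x≢y (inj₂ (inj₂ (x∈VE , depOf⊆Dy))) =
        SuppIn-mono (∩-map (depOf⊆Dy ∘ depOf⇔ similar x≢y .from) (VA⇔ similar .from))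
          (proj₂ (proj₂ (valuation-candidateAt cand′ (q⊆p∪q _ _ x∈VE′))) x∈VE′)
        where
        x∈VE′ = VE⇔ similar x≢y .to x∈VE

      witness : CandFun P′ → Assignment → Bool
      witness s′ a = eval (valuation P′ s′ a) (subst φ y true)

      witness-supp : (∀ x → x ∈ Vars φ → Determined x) → {s′ : CandFun P′} → IsCandidate P′ s′ →
        SuppIn (witness s′) (depOf P y ∩ VA P)
      witness-supp determined {s′} cand′ =
        SuppIn-mono (∩-map (depOf⊆depOf-plug C y ∘ Dy⊆depOf-∃) id) λ a b agree →
          let τ = valuation P′ s′ a; τ′ = valuation P′ s′ b in begin
          eval τ (subst φ y true)     ≡⟨ eval-subst τ y true qf ⟩
          eval (update τ y true) φ    ≡⟨ eval-cong φ (λ x∈φ → update-cong τ τ′ true λ x≢y →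
                                           determined-supp cand′ x≢y (determined _ x∈φ) a b agree) ⟩
          eval (update τ′ y true) φ   ≡⟨ sym (eval-subst τ′ y true qf) ⟩
          eval τ′ (subst φ y true)    ∎

      expansion-satisfiable⇒satisfiable : (∀ x → x ∈ Vars φ → Determined x) →
        Σ (CandFun P′) (InSem P′) → Σ (CandFun P) (InSem P)
      expansion-satisfiable⇒satisfiable determined (s′ , inSem′@(cand′ , _)) =
        s , override-inSem C s′ (witness s′) (Similar-sym similar) y∉sideVars
              (existential-candidateAt {ψ = P} y∈VE (witness-supp determined cand′)) in-hole inSem′
        where
        s : CandFun P
        s = override P′ s′ y (witness s′) P

        in-hole : ∀ a → (∀ {x} → x ≢ y → valuation P′ s′ a x ≡ valuation P s a x) →
          T (eval (valuation P′ s′ a) (or (subst φ y false) (subst φ y true))) → T (eval (valuation P s a) φ)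
        in-hole a agree = ≡.subst T (begin
          g false ∨ g true  ≡⟨ ∨-at-witness g ⟩
          g (witness s′ a)  ≡⟨ cong g (sym (valuation-override-≡ (q⊆p∪q _ _ y∈VE) a)) ⟩
          g (σ y)           ≡⟨ sym (eval-agreeing qf (sym ∘ agree)) ⟩
          eval σ φ          ∎)
          where
          σ : Assignment
          σ = valuation P s a
          g : Bool → Bool
          g c = eval (valuation P′ s′ a) (subst φ y c)

theorem7 : {n : ℕ} (C : Ctx n) (y : Fin n) (Dy : Subset n) (φ : Form n) →
    WF (plug C (ex y Dy φ)) →
    VA φ ≡ ∅ → VE φ ≡ ∅ →
    ((x : Fin n) → x ∈ Vars φ →
      x ∈ Dy ⊎ x ∈ Vfree (plug C (ex y Dy φ)) ⊎
      (x ∈ VE (plug C (ex y Dy φ)) × depOf (plug C (ex y Dy φ)) x ⊆ Dy)) →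
    Equisat (plug C (ex y Dy φ)) (plug C (or (subst φ y false) (subst φ y true)))
theorem7 C y Dy φ wf VA≡∅ VE≡∅ determined =
  (λ unsat → unsat ∘ expansion-satisfiable⇒satisfiable scoped determined) ,
  (λ unsat′ → unsat′ ∘ satisfiable⇒expansion-satisfiable scoped)
  where
  qf : QF φ
  qf = unquantified⇒QF φ ([ ∉⊥ ∘ ≡.subst (_ ∈_) VE≡∅ , ∉⊥ ∘ ≡.subst (_ ∈_) VA≡∅ ]′ ∘ x∈p∪q⁻ _ _)

  open Expansion C y Dy φ qf

  scoped : WellScoped P
  scoped = WF⇒WellScoped wf
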